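{- Let $H$ be a finite hypergraph and $f$ a rotation of order $n$ in $H$ with components $U_0,\ldots,U_{n-1}$ such that $V(H)=\bigcup_{i=0}^{n-1}U_i$, i.e. the invariant set is empty. Let $M_H$ be an $f$-compatible matrix. Then for every $n$-th root of unity $\omega$ (including $\omega=1$), every eigenvalue of $M^{\omega}_H(f,U_0)$ is an eigenvalue of $M_H$.
   Context: A hypergraph $H$ is a pair $(V(H),E(H))$ with $V(H)$ a nonempty finite set and $E(H)$ a set of nonempty subsets of $V(H)$. An automorphism of $H$ is a bijection $f:V(H)\to V(H)$ such that for every subset $e\subseteq V(H)$, $e\in E(H)$ if and only if $\{f(v):v\in e\}\in E(H)$. For an integer $n\ge 2$, a rotation of order $n$ in $H$ is an automorphism $f$ of $H$ with $f^n=\mathrm{id}$ such that $V(H)$ is partitioned into pairwise disjoint sets $V(H)=U_0\cup\cdots\cup U_{n-1}\cup X$ with $f(v)=v$ for $v\in X$, $U_{i+1}=\{f(v):v\in U_i\}$ for $i=0,\ldots,n-2$, and $U_0=\{f(v):v\in U_{n-1}\}$; $U_i$ is the $i$-th component and $X$ the invariant set. A complex square matrix $M_H=(m_{uv})_{u,v\in V(H)}$ is $f$-compatible if $m_{uv}=m_{f(u)f(v)}$ for all $u,v$. For an $n$-th root of unity $\omega$, $M^{\omega}_H(f,U_0)=(r_{uv})_{u,v\in U_0}$ with $r_{uv}=\sum_{i=0}^{n-1}\omega^i m_{uf^i(v)}$. -}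

module Defs where

open import Level using (Level)
open import Data.Nat as ℕ using (ℕ; zero; suc; _<?_; _≤_)
open import Data.Fin as Fin using (Fin; toℕ; fromℕ<)
open import Data.Fin.Subset using (Subset; Nonempty)
open import Data.Fin.Permutation using (Permutation′; _⟨$⟩ʳ_; _⟨$⟩ˡ_)
open import Data.Vec using (tabulate; lookup)
open import Data.Bool using (Bool; true; false; if_then_else_)
open import Data.Product using (Σ; ∃; _×_; _,_)
open import Relation.Binary.PropositionalEquality using (_≡_)
open import Relation.Nullary using (¬_; yes; no)
open import Function.Bundles using (_⇔_)
open import Algebra.Bundles using (CommutativeRing)

iter : ∀ {a} {A : Set a} → ℕ → (A → A) → A → A
iter zero    g x = x
iter (suc k) g x = g (iter k g x)

csuc : ∀ {n} → Fin n → Fin n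
csuc {suc m} i with suc (toℕ i) <? suc m
... | yes p = fromℕ< p
... | no  _ = Fin.zero

record Hypergraph (N : ℕ) : Set₁ where
  field
    vertexNonempty : 1 ≤ N
    IsEdge         : Subset N → Set
    edgeNonempty   : ∀ e → IsEdge e → Nonempty e

image : ∀ {N} → Permutation′ N → Subset N → Subset N
image f e = tabulate (λ w → lookup e (f ⟨$⟩ˡ w))

IsAutomorphism : ∀ {N} → Hypergraph N → Permutation′ N → Set
IsAutomorphism H f = ∀ e → Hypergraph.IsEdge H e ⇔ Hypergraph.IsEdge H (image f e)

_∈S_ : ∀ {N} → Fin N → Subset N → Set
v ∈S S = lookup S v ≡ true

record IsRotationNoFixed {N : ℕ} (H : Hypergraph N) (n : ℕ)
         (f : Permutation′ N) (U : Fin n → Subset N) : Set where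
  field
    order≥2   : 2 ≤ n
    automorph : IsAutomorphism H f
    periodic  : ∀ v → iter n (f ⟨$⟩ʳ_) v ≡ v
    disjoint  : ∀ i j v → v ∈S U i → v ∈S U j → i ≡ j
    cover     : ∀ v → ∃ λ i → v ∈S U i
    shift     : ∀ i → image f (U i) ≡ U (csuc i)

module _ {c ℓ} (R : CommutativeRing c ℓ) where
  open CommutativeRing R

  Matrix : ℕ → Set c
  Matrix N = Fin N → Fin N → Carrier

  ∑ : ∀ {N} → (Fin N → Carrier) → Carrier
  ∑ {zero}  g = 0#
  ∑ {suc N} g = g Fin.zero + ∑ (λ i → g (Fin.suc i))

  pow : Carrier → ℕ → Carrier
  pow x zero    = 1#
  pow x (suc k) = x * pow x k

  IsRootOfUnity : ℕ → Carrier → Set ℓ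
  IsRootOfUnity n ω = pow ω n ≈ 1#

  Compatible : ∀ {N} → Permutation′ N → Matrix N → Set ℓ
  Compatible f M = ∀ u v → M u v ≈ M (f ⟨$⟩ʳ u) (f ⟨$⟩ʳ v)

  -- r_uv = Σ_{i<n} ω^i m_{u, f^i(v)}  (only used for u, v ∈ U₀)
  Mω : ∀ {N} → (n : ℕ) → Permutation′ N → Matrix N → Carrier → Matrix N
  Mω n f M ω u v = ∑ {n} (λ i → pow ω (toℕ i) * M u (iter (toℕ i) (f ⟨$⟩ʳ_) v))

  IsEigenvalueOn : ∀ {N} → Subset N → Matrix N → Carrier → Set (c Level.⊔ ℓ)
  IsEigenvalueOn S M λ′ = Σ (Fin _ → Carrier) λ x →
      (¬ (∀ v → v ∈S S → x v ≈ 0#))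
    × (∀ u → u ∈S S →
         ∑ (λ v → if lookup S v then M u v * x v else 0#) ≈ λ′ * x u)

  IsEigenvalue : ∀ {N} → Matrix N → Carrier → Set (c Level.⊔ ℓ)
  IsEigenvalue {N} M λ′ = Σ (Fin N → Carrier) λ x →
      (¬ (∀ v → x v ≈ 0#)) × (∀ u → ∑ (λ v → M u v * x v) ≈ λ′ * x u)

  -- field axioms (the paper works over ℂ)
  IsField : Set (c Level.⊔ ℓ)
  IsField = (¬ (1# ≈ 0#)) × (∀ x → ¬ (x ≈ 0#) → ∃ λ y → x * y ≈ 1#)

-- Spread an eigenvector x of M^ω on U₀ around the orbits of f: y (f^j u) = ω^j x u for u ∈ U₀,
-- i.e. y w = Σ_{j<n} ω^j x̂ (f^{-j} w) with x̂ the extension of x by zero.  Since f^n = id and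
-- ω^n = 1, y satisfies the twisted invariance y ∘ f = ω y, and f-compatibility of M passes
-- this invariance on to M y.  On U₀ reindexing the double sum gives (M y) u = (M^ω x) u = λ x u,
-- and two twisted-invariant vectors that agree on U₀ agree everywhere, because U₀ meets every
-- orbit of f.
module Submission where

open import Defs
open import Data.Nat as ℕ using (ℕ; zero; suc; _<_; _<?_; s≤s)
open import Data.Nat.Properties as ℕₚ using (<⇒≤; 0≢1+n)
open import Data.Fin as Fin using (Fin; toℕ)
open import Data.Fin.Properties using (toℕ-fromℕ<; toℕ-injective; toℕ<n)
open import Data.Fin.Subset using (Subset)
open import Data.Fin.Permutation using (Permutation′; _⟨$⟩ʳ_; _⟨$⟩ˡ_; inverseˡ; inverseʳ)
open import Data.Vec using (lookup)
open import Data.Vec.Properties using (lookup∘tabulate)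
open import Data.Bool using (true; false; if_then_else_)
open import Data.Product using (∃; _,_)
open import Data.Empty using (⊥-elim)
open import Relation.Nullary using (¬_; yes; no)
open import Relation.Binary.PropositionalEquality as ≡ using (_≡_; cong; subst)
open import Function.Base using (_∘_)
open import Algebra.Bundles using (CommutativeRing)

iter-suc : ∀ {a} {A : Set a} j (h : A → A) x → iter (suc j) h x ≡ iter j h (h x)
iter-suc zero    h x = ≡.refl
iter-suc (suc j) h x = cong h (iter-suc j h x)

module _ {a} {A : Set a} {g h : A → A} (g∘h≡id : ∀ x → g (h x) ≡ x) where

  iter-suc-cancel : ∀ j x → iter (suc j) g (h x) ≡ iter j g x
  iter-suc-cancel j x = ≡.trans (iter-suc j g (h x)) (cong (iter j g) (g∘h≡id x))

  iter-inverse : ∀ j x → iter j g (iter j h x) ≡ x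
  iter-inverse zero    x = ≡.refl
  iter-inverse (suc j) x = ≡.trans (iter-suc-cancel j (iter j h x)) (iter-inverse j x)

  iter-inverse-period : ∀ m → (∀ x → iter (suc m) h x ≡ x) → ∀ x → iter m g x ≡ h x
  iter-inverse-period m period x = begin
    iter m g x                          ≡⟨ cong (iter m g) (period x) ⟨
    iter m g (iter (suc m) h x)         ≡⟨ cong (iter m g) (iter-suc m h x) ⟩
    iter m g (iter m h (h x))           ≡⟨ iter-inverse m (h x) ⟩
    h x                                 ∎
    where open ≡.≡-Reasoning

toℕ-csuc : ∀ {n} (i : Fin n) → suc (toℕ i) < n → toℕ (csuc i) ≡ suc (toℕ i)
toℕ-csuc {suc m} i i+1<n with suc (toℕ i) <? suc m
... | yes i+1<n′ = toℕ-fromℕ< i+1<n′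
... | no  i+1≮n  = ⊥-elim (i+1≮n i+1<n)

toℕ-iter-csuc : ∀ {n} (i : Fin n) j → toℕ i ℕ.+ j < n → toℕ (iter j csuc i) ≡ toℕ i ℕ.+ j
toℕ-iter-csuc i zero    _       = ≡.sym (ℕₚ.+-identityʳ (toℕ i))
toℕ-iter-csuc {n} i (suc j) i+j+1<n = begin
  toℕ (csuc (iter j csuc i)) ≡⟨ toℕ-csuc _ (subst (λ k → suc k < n) (≡.sym ih) i+j+1<n′) ⟩
  suc (toℕ (iter j csuc i))  ≡⟨ cong suc ih ⟩
  suc (toℕ i ℕ.+ j)          ≡⟨ ℕₚ.+-suc (toℕ i) j ⟨
  toℕ i ℕ.+ suc j            ∎
  where
  open ≡.≡-Reasoning
  i+j+1<n′ : suc (toℕ i ℕ.+ j) < n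
  i+j+1<n′ = subst (_< n) (ℕₚ.+-suc (toℕ i) j) i+j+1<n
  ih : toℕ (iter j csuc i) ≡ toℕ i ℕ.+ j
  ih = toℕ-iter-csuc i j (<⇒≤ i+j+1<n′)

∈-image⁺ : ∀ {N} (π : Permutation′ N) {e v} → v ∈S e → (π ⟨$⟩ʳ v) ∈S image π e
∈-image⁺ π {e} {v} v∈e = ≡.trans (lookup∘tabulate (λ w → lookup e (π ⟨$⟩ˡ w)) (π ⟨$⟩ʳ v))
                                  (≡.trans (cong (lookup e) (inverseˡ π)) v∈e)

∈-image⁻ : ∀ {N} (π : Permutation′ N) {e w} → w ∈S image π e → (π ⟨$⟩ˡ w) ∈S e
∈-image⁻ π {e} {w} w∈πe = ≡.trans (≡.sym (lookup∘tabulate _ w)) w∈πe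

module Rotation {N} {H : Hypergraph N} {n} {f : Permutation′ N} {U : Fin n → Subset N}
                (rot : IsRotationNoFixed H n f U) where
  open IsRotationNoFixed rot

  ∈-iter-shift : ∀ j {i v} → v ∈S U i → iter j (f ⟨$⟩ʳ_) v ∈S U (iter j csuc i)
  ∈-iter-shift zero    v∈Uᵢ = v∈Uᵢ
  ∈-iter-shift (suc j) {v = v} v∈Uᵢ =
    subst (iter (suc j) (f ⟨$⟩ʳ_) v ∈S_) (shift _)
          (∈-image⁺ f {U (iter j csuc _)} (∈-iter-shift j v∈Uᵢ))

  ∈-iter-unshift : ∀ j {i w} → w ∈S U (iter j csuc i) → iter j (f ⟨$⟩ˡ_) w ∈S U i
  ∈-iter-unshift zero    w∈U = w∈U
  ∈-iter-unshift (suc j) {i} {w} w∈U = subst (_∈S U i) (≡.sym (iter-suc j (f ⟨$⟩ˡ_) w))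
    (∈-iter-unshift j (∈-image⁻ f {U (iter j csuc i)} (subst (w ∈S_) (≡.sym (shift _)) w∈U)))

  module _ {i₀ : Fin n} (i₀≡0 : toℕ i₀ ≡ 0) where

    toℕ-component : ∀ j → j < n → toℕ (iter j csuc i₀) ≡ j
    toℕ-component j j<n =
      ≡.trans (toℕ-iter-csuc i₀ j (subst (λ k → k ℕ.+ j < n) (≡.sym i₀≡0) j<n)) (cong (ℕ._+ j) i₀≡0)

    component₀-reaches : ∀ w → ∃ λ j → iter j (f ⟨$⟩ˡ_) w ∈S U i₀
    component₀-reaches w with cover w
    ... | i , w∈Uᵢ = toℕ i , ∈-iter-unshift (toℕ i) (subst (λ k → w ∈S U k) (≡.sym i≡) w∈Uᵢ)
      where
      i≡ : iter (toℕ i) csuc i₀ ≡ i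
      i≡ = toℕ-injective (toℕ-component (toℕ i) (toℕ<n i))

    component₀-no-return : ∀ {u j} → u ∈S U i₀ → suc j < n → ¬ iter (suc j) (f ⟨$⟩ˡ_) u ∈S U i₀
    component₀-no-return {u} {j} u∈U₀ j+1<n back∈U₀ = 0≢1+n (begin
      0                                ≡⟨ i₀≡0 ⟨
      toℕ i₀                           ≡⟨ cong toℕ (disjoint _ _ u u∈Uⱼ u∈U₀) ⟨
      toℕ (iter (suc j) csuc i₀)       ≡⟨ toℕ-component (suc j) j+1<n ⟩
      suc j                            ∎)
      where
      open ≡.≡-Reasoning
      u∈Uⱼ : u ∈S U (iter (suc j) csuc i₀)
      u∈Uⱼ = subst (_∈S U (iter (suc j) csuc i₀))
                   (iter-inverse {g = f ⟨$⟩ʳ_} (λ _ → inverseʳ f) (suc j) u)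
                   (∈-iter-shift (suc j) back∈U₀)

module Linear {c ℓ} (K : CommutativeRing c ℓ) where
  open CommutativeRing K
  open import Algebra.Properties.Semiring.Sum semiring as Sum using (sum)
  open import Relation.Binary.Reasoning.Setoid setoid

  ∑≡sum : ∀ {N} (g : Fin N → Carrier) → ∑ K g ≡ sum g
  ∑≡sum {zero}  g = ≡.refl
  ∑≡sum {suc N} g = cong (g Fin.zero +_) (∑≡sum (g ∘ Fin.suc))

  ∑-≈-via-sum : ∀ {M N} {g : Fin M → Carrier} {h : Fin N → Carrier} →
                sum g ≈ sum h → ∑ K g ≈ ∑ K h
  ∑-≈-via-sum {g = g} {h} sumg≈sumh =
    trans (reflexive (∑≡sum g)) (trans sumg≈sumh (reflexive (≡.sym (∑≡sum h))))

  ∑-cong : ∀ {N} {g h : Fin N → Carrier} → (∀ i → g i ≈ h i) → ∑ K g ≈ ∑ K h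
  ∑-cong {N} {g} {h} g≈h = ∑-≈-via-sum {N} {N} {g} {h} (Sum.sum-cong-≋ g≈h)

  ∑-zero : ∀ N → ∑ K {N} (λ _ → 0#) ≈ 0#
  ∑-zero N = trans (reflexive (∑≡sum {N} (λ _ → 0#))) (Sum.sum-replicate-zero N)

  ∑-permute : ∀ {N} (π : Permutation′ N) (g : Fin N → Carrier) → ∑ K g ≈ ∑ K (g ∘ (π ⟨$⟩ʳ_))
  ∑-permute {N} π g = ∑-≈-via-sum {N} {N} (Sum.∑-permute g π)

  ∑-permute-iter : ∀ {N} (π : Permutation′ N) j (g : Fin N → Carrier) →
                   ∑ K g ≈ ∑ K (λ v → g (iter j (π ⟨$⟩ʳ_) v))
  ∑-permute-iter π zero    g = refl
  ∑-permute-iter π (suc j) g = trans (∑-permute-iter π j g) (trans (∑-permute π _)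
    (∑-cong (λ v → reflexive (cong g (≡.sym (iter-suc j (π ⟨$⟩ʳ_) v))))))

  ∑-comm : ∀ {A B} (h : Fin A → Fin B → Carrier) →
           ∑ K (λ a → ∑ K (h a)) ≈ ∑ K (λ b → ∑ K (λ a → h a b))
  ∑-comm {A} {B} h = ∑-≈-via-sum {A} {B} (begin
    sum (λ a → ∑ K (h a))               ≈⟨ Sum.sum-cong-≋ (λ a → reflexive (∑≡sum (h a))) ⟩
    sum (λ a → sum (h a))               ≈⟨ Sum.∑-comm h ⟩
    sum (λ b → sum (λ a → h a b))       ≈⟨ Sum.sum-cong-≋ (λ b → reflexive (∑≡sum (λ a → h a b))) ⟨
    sum (λ b → ∑ K (λ a → h a b))       ∎)

  *-distribˡ-∑ : ∀ {N} x (g : Fin N → Carrier) → x * ∑ K g ≈ ∑ K (λ i → x * g i)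
  *-distribˡ-∑ x g = begin
    x * ∑ K g                ≈⟨ *-congˡ (reflexive (∑≡sum g)) ⟩
    x * sum g                ≈⟨ Sum.*-distribˡ-sum x g ⟩
    sum (λ i → x * g i)      ≡⟨ ∑≡sum (λ i → x * g i) ⟨
    ∑ K (λ i → x * g i)      ∎

  *-distribʳ-∑ : ∀ {N} x (g : Fin N → Carrier) → ∑ K g * x ≈ ∑ K (λ i → g i * x)
  *-distribʳ-∑ x g = begin
    ∑ K g * x                ≈⟨ *-congʳ (reflexive (∑≡sum g)) ⟩
    sum g * x                ≈⟨ Sum.*-distribʳ-sum x g ⟩
    sum (λ i → g i * x)      ≡⟨ ∑≡sum (λ i → g i * x) ⟨
    ∑ K (λ i → g i * x)      ∎

  ∑< : ℕ → (ℕ → Carrier) → Carrier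
  ∑< n h = ∑ K {n} (h ∘ toℕ)

  ∑<-snoc : ∀ m (h : ℕ → Carrier) → ∑< (suc m) h ≈ ∑< m h + h m
  ∑<-snoc zero    h = trans (+-identityʳ _) (sym (+-identityˡ _))
  ∑<-snoc (suc m) h = trans (+-congˡ (∑<-snoc m (h ∘ suc))) (sym (+-assoc _ _ _))

  ∑<-head : ∀ m (h : ℕ → Carrier) → (∀ j → j < m → h (suc j) ≈ 0#) → ∑< (suc m) h ≈ h 0
  ∑<-head m h tail≈0 = begin
    h 0 + ∑< m (h ∘ suc)      ≈⟨ +-congˡ (∑-cong (λ i → tail≈0 (toℕ i) (toℕ<n i))) ⟩
    h 0 + ∑ K {m} (λ _ → 0#)  ≈⟨ +-congˡ (∑-zero m) ⟩
    h 0 + 0#                  ≈⟨ +-identityʳ _ ⟩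
    h 0                       ∎

  _*ᵥ_ : ∀ {N} → Matrix K N → (Fin N → Carrier) → Fin N → Carrier
  (M *ᵥ y) u = ∑ K (λ v → M u v * y v)

  restrict : ∀ {N} → Subset N → (Fin N → Carrier) → Fin N → Carrier
  restrict S x v = if lookup S v then x v else 0#

  restrict-∈ : ∀ {N} {S : Subset N} x {v} → v ∈S S → restrict S x v ≡ x v
  restrict-∈ x v∈S rewrite v∈S = ≡.refl

  restrict-∉ : ∀ {N} {S : Subset N} x {v} → ¬ v ∈S S → restrict S x v ≡ 0#
  restrict-∉ {S = S} x {v} v∉S with lookup S v
  ... | true  = ⊥-elim (v∉S ≡.refl)
  ... | false = ≡.refl

  *-restrict : ∀ {N} (S : Subset N) a x v →
               a * restrict S x v ≈ (if lookup S v then a * x v else 0#)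
  *-restrict S a x v with lookup S v
  ... | true  = refl
  ... | false = zeroʳ a

module Orbits {c ℓ} (K : CommutativeRing c ℓ) {N} (f : Permutation′ N)
              (ω : CommutativeRing.Carrier K) where
  open CommutativeRing K
  open Linear K
  open import Algebra.Properties.CommutativeSemigroup *-commutativeSemigroup
    using (x∙yz≈y∙xz; x∙yz≈yx∙z)
  open import Relation.Binary.Reasoning.Setoid setoid

  private
    F G : Fin N → Fin N
    F = f ⟨$⟩ʳ_
    G = f ⟨$⟩ˡ_

  Equivariant : (Fin N → Carrier) → Set ℓ
  Equivariant y = ∀ w → y (F w) ≈ ω * y w

  scale-equivariant : ∀ a {y} → Equivariant y → Equivariant (λ w → a * y w)
  scale-equivariant a {y} y-eqv w = trans (*-congˡ (y-eqv w)) (x∙yz≈y∙xz a ω (y w))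

  *ᵥ-equivariant : ∀ {M y} → Compatible K f M → Equivariant y → Equivariant (M *ᵥ y)
  *ᵥ-equivariant {M} {y} compat y-eqv w = begin
    ∑ K (λ v → M (F w) v * y v)          ≈⟨ ∑-permute f (λ v → M (F w) v * y v) ⟩
    ∑ K (λ v → M (F w) (F v) * y (F v))  ≈⟨ ∑-cong (λ v → *-cong (sym (compat w v)) (y-eqv v)) ⟩
    ∑ K (λ v → M w v * (ω * y v))        ≈⟨ ∑-cong (λ v → x∙yz≈y∙xz (M w v) ω (y v)) ⟩
    ∑ K (λ v → ω * (M w v * y v))        ≈⟨ *-distribˡ-∑ ω (λ v → M w v * y v) ⟨
    ω * (M *ᵥ y) w                       ∎

  equivariant-≈-iter : ∀ {x y} → Equivariant x → Equivariant y →
                       ∀ {u} → x u ≈ y u → ∀ j → x (iter j F u) ≈ y (iter j F u)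
  equivariant-≈-iter x-eqv y-eqv xu≈yu zero    = xu≈yu
  equivariant-≈-iter x-eqv y-eqv xu≈yu (suc j) =
    trans (x-eqv _) (trans (*-congˡ (equivariant-≈-iter x-eqv y-eqv xu≈yu j)) (sym (y-eqv _)))

  equivariant-≈-from-component₀ :
    ∀ {H : Hypergraph N} {n U} → IsRotationNoFixed H n f U → ∀ {i₀} → toℕ i₀ ≡ 0 →
    ∀ {x y} → Equivariant x → Equivariant y → (∀ u → u ∈S U i₀ → x u ≈ y u) → ∀ w → x w ≈ y w
  equivariant-≈-from-component₀ rot i₀≡0 {x} {y} x-eqv y-eqv x≈y w
    with Rotation.component₀-reaches rot i₀≡0 w
  ... | j , Gʲw∈U₀ = subst (λ v → x v ≈ y v) (iter-inverse (λ _ → inverseʳ f) j w)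
                           (equivariant-≈-iter x-eqv y-eqv (x≈y _ Gʲw∈U₀) j)

  orbitSum : ℕ → (Fin N → Carrier) → Fin N → Carrier
  orbitSum n z w = ∑< n (λ j → pow K ω j * z (iter j G w))

  orbitSum-head : ∀ m z w → (∀ j → j < m → z (iter (suc j) G w) ≈ 0#) →
                  orbitSum (suc m) z w ≈ z w
  orbitSum-head m z w tail≈0 =
    trans (∑<-head m (λ j → pow K ω j * z (iter j G w))
                 (λ j j<m → trans (*-congˡ (tail≈0 j j<m)) (zeroʳ _))) (*-identityˡ (z w))

  orbitSum-equivariant : ∀ n z → (∀ v → iter n F v ≡ v) → IsRootOfUnity K n ω →
                         Equivariant (orbitSum n z)
  orbitSum-equivariant zero    z _      _    w = sym (zeroʳ ω)
  orbitSum-equivariant (suc m) z period ωⁿ≈1 w = begin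
    orbitSum (suc m) z (F w)         ≡⟨⟩
    1# * z (F w) + ∑< m (λ j → (ω * pow K ω j) * z (iter (suc j) G (F w)))
      ≈⟨ +-cong wrap-around (∑-cong {m} (λ i → shifted (toℕ i))) ⟩
    ω * t m + ∑< m (λ j → ω * t j)   ≈⟨ +-comm _ _ ⟩
    ∑< m (λ j → ω * t j) + ω * t m   ≈⟨ +-congʳ (*-distribˡ-∑ {m} ω (t ∘ toℕ)) ⟨
    ω * ∑< m t + ω * t m             ≈⟨ distribˡ ω _ _ ⟨
    ω * (∑< m t + t m)               ≈⟨ *-congˡ (∑<-snoc m t) ⟨
    ω * orbitSum (suc m) z w         ∎
    where
    t : ℕ → Carrier
    t j = pow K ω j * z (iter j G w)
    wrap-around : 1# * z (F w) ≈ ω * t m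
    wrap-around = begin
      1# * z (F w)                          ≈⟨ *-congʳ ωⁿ≈1 ⟨
      pow K ω (suc m) * z (F w)             ≡⟨ cong (λ v → pow K ω (suc m) * z v)
                                                 (iter-inverse-period (λ _ → inverseˡ f) m period w) ⟨
      (ω * pow K ω m) * z (iter m G w)      ≈⟨ *-assoc ω _ _ ⟩
      ω * t m                               ∎
    shifted : ∀ j → (ω * pow K ω j) * z (iter (suc j) G (F w)) ≈ ω * t j
    shifted j = trans (*-assoc ω _ _)
      (*-congˡ (*-congˡ (reflexive (cong z (iter-suc-cancel (λ _ → inverseˡ f) j w)))))

  *ᵥ-orbitSum : ∀ n M z u → (M *ᵥ orbitSum n z) u ≈ ∑ K (λ v → Mω K n f M ω u v * z v)
  *ᵥ-orbitSum n M z u = begin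
    ∑ K (λ w → M u w * orbitSum n z w)
      ≈⟨ ∑-cong (λ w → *-distribˡ-∑ {n} (M u w) (λ i → t (toℕ i) w)) ⟩
    ∑ K (λ w → ∑< n (λ j → M u w * t j w))
      ≈⟨ ∑-comm {N} {n} (λ w i → M u w * t (toℕ i) w) ⟩
    ∑< n (λ j → ∑ K (λ w → M u w * t j w))
      ≈⟨ ∑-cong {n} (λ i → ∑-permute-iter f (toℕ i) (λ w → M u w * t (toℕ i) w)) ⟩
    ∑< n (λ j → ∑ K (λ v → M u (iter j F v) * t j (iter j F v)))
      ≈⟨ ∑-cong {n} (λ i → ∑-cong (regroup (toℕ i))) ⟩
    ∑< n (λ j → ∑ K (λ v → s j v * z v))
      ≈⟨ ∑-comm {n} {N} (λ i v → s (toℕ i) v * z v) ⟩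
    ∑ K (λ v → ∑< n (λ j → s j v * z v))
      ≈⟨ ∑-cong (λ v → *-distribʳ-∑ {n} (z v) (λ i → s (toℕ i) v)) ⟨
    ∑ K (λ v → Mω K n f M ω u v * z v) ∎
    where
    t s : ℕ → Fin N → Carrier
    t j w = pow K ω j * z (iter j G w)
    s j v = pow K ω j * M u (iter j F v)
    regroup : ∀ j v → M u (iter j F v) * t j (iter j F v) ≈ s j v * z v
    regroup j v = trans (x∙yz≈yx∙z _ _ _)
      (*-congˡ (reflexive (cong z (iter-inverse (λ _ → inverseˡ f) j v))))

  *ᵥ-orbitSum-restrict : ∀ n M S x u → (M *ᵥ orbitSum n (restrict S x)) u ≈
                         ∑ K (λ v → if lookup S v then Mω K n f M ω u v * x v else 0#)
  *ᵥ-orbitSum-restrict n M S x u = trans (*ᵥ-orbitSum n M (restrict S x) u)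
    (∑-cong (λ v → *-restrict S (Mω K n f M ω u v) x v))

  orbitSum-restrict-component₀ :
    ∀ {H : Hypergraph N} {m U} → IsRotationNoFixed H (suc m) f U → ∀ {i₀} → toℕ i₀ ≡ 0 →
    ∀ x {u} → u ∈S U i₀ → orbitSum (suc m) (restrict (U i₀) x) u ≈ x u
  orbitSum-restrict-component₀ {m = m} {U} rot {i₀} i₀≡0 x {u} u∈U₀ = trans
    (orbitSum-head m (restrict (U i₀) x) u (λ j j<m → reflexive
      (restrict-∉ {S = U i₀} x (Rotation.component₀-no-return rot i₀≡0 u∈U₀ (s≤s j<m)))))
    (reflexive (restrict-∈ {S = U i₀} x u∈U₀))

mainTheorem8 : ∀ {c ℓ} (K : CommutativeRing c ℓ) → IsField K →
    ∀ {N : ℕ} (H : Hypergraph N) (n : ℕ) (f : Permutation′ N) (U : Fin n → Subset N) →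
    IsRotationNoFixed H n f U →
    (M : Matrix K N) → Compatible K f M →
    (ω : CommutativeRing.Carrier K) → IsRootOfUnity K n ω →
    (λ′ : CommutativeRing.Carrier K) →
    (i₀ : Fin n) → toℕ i₀ ≡ 0 →
    IsEigenvalueOn K (U i₀) (Mω K n f M ω) λ′ → IsEigenvalue K M λ′
mainTheorem8 K _ H zero    f U rot M compat ω ωⁿ≈1 λ′ () _ _
mainTheorem8 K _ H (suc m) f U rot M compat ω ωⁿ≈1 λ′ i₀ i₀≡0 (x , x≉0 , Mωx≈λx) =
  y , y≉0 , equivariant-≈-from-component₀ rot i₀≡0
              (*ᵥ-equivariant compat y-eqv) (scale-equivariant λ′ y-eqv) My≈λy-on-U₀
  where
  open CommutativeRing K
  open Linear K
  open Orbits K f ω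
  open IsRotationNoFixed rot using (periodic)

  y : Fin _ → Carrier
  y = orbitSum (suc m) (restrict (U i₀) x)

  y-eqv : Equivariant y
  y-eqv = orbitSum-equivariant (suc m) (restrict (U i₀) x) periodic ωⁿ≈1

  y≈x-on-U₀ : ∀ u → u ∈S U i₀ → y u ≈ x u
  y≈x-on-U₀ u u∈U₀ = orbitSum-restrict-component₀ rot i₀≡0 x u∈U₀

  y≉0 : ¬ (∀ v → y v ≈ 0#)
  y≉0 y≈0 = x≉0 (λ v v∈U₀ → trans (sym (y≈x-on-U₀ v v∈U₀)) (y≈0 v))

  My≈λy-on-U₀ : ∀ u → u ∈S U i₀ → (M *ᵥ y) u ≈ λ′ * y u
  My≈λy-on-U₀ u u∈U₀ = trans (*ᵥ-orbitSum-restrict (suc m) M (U i₀) x u)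
    (trans (Mωx≈λx u u∈U₀) (*-congˡ (sym (y≈x-on-U₀ u u∈U₀))))
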